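{- Let $m\ge 3$ be an odd integer and let $n\ge 6$ be an even integer. (1) If $n\equiv 2\pmod 4$, then the number of Klein bottle nonequivalent $C_4$-face-magic Klein bottle labelings of $\mathcal{K}_{m,n}$ is at least $(6\cdot 2^m)(m-1)!$. (2) If $n\equiv 0\pmod 4$, then the number of Klein bottle nonequivalent $C_4$-face-magic Klein bottle labelings of $\mathcal{K}_{m,n}$ is at least $(5\cdot 2^m)(m-1)!$.
   Context: For integers $m,n\ge 2$, the $m\times n$ Klein bottle grid graph $\mathcal{K}_{m,n}$ has vertex set $\{(i,j):1\le i\le m,\ 1\le j\le n\}$ and edges $(i,j)(i,j+1)$ for $1\le j\le n-1$; $(i,n)(i,1)$; $(i,j)(i+1,j)$ for $1\le i\le m-1$; and $(m,j)(1,n+1-j)$ for $1\le j\le n$. Its $4$-cycle faces in the natural Klein bottle embedding are, with column indices modulo $n$, $\{(i,j),(i,j+1),(i+1,j),(i+1,j+1)\}$ for $1\le i\le m-1$, $1\le j\le n$, and $\{(m,j),(m,j+1),(1,n+1-j),(1,n-j)\}$ for $1\le j\le n$. A $C_4$-face-magic Klein bottle labeling is a bijection $X=\{x_{i,j}\}$ from the vertices to $\{1,\dots,mn\}$ such that all these $4$-cycle face sums are equal. For $n$ even, define $U(i,j)=(i+1,j)$ for $1\le i\le m-1$, $U(m,j)=(1,n+1-j)$; $H(i,j)=(i,j+n/2)$ (column index modulo $n$); $F(i,j)=(i,n+1-j)$; let $KBLS(m,n)=\langle U,H,F\rangle$ (the graph automorphisms induced by homeomorphisms of the Klein bottle preserving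 the embedded graph). For $A\in KBLS(m,n)$ let $A(X)=\{x_{A(i,j)}\}$. Two labelings $X,X'$ are Klein bottle equivalent if $X'=A(X)$ for some $A\in KBLS(m,n)$; "number of nonequivalent labelings" means the number of equivalence classes. -}

module Defs where

open import Data.Nat using (ℕ; zero; suc; _+_; _*_; _∸_; _<?_; _/_)
open import Data.Nat.DivMod using (_mod_)
open import Data.Fin using (Fin; toℕ; fromℕ<; opposite)
open import Data.Product using (_×_; _,_; Σ; ∃)
open import Function.Bundles using (_⤖_; Bijection)
open import Function.Base using (_∘_; id)
open import Relation.Nullary using (yes; no)
open import Relation.Binary.PropositionalEquality using (_≡_)

-- Vertices of K_{m,n}, 0-indexed: (i , j) stands for the paper's (i+1 , j+1).
Vertex : ℕ → ℕ → Set
Vertex m n = Fin m × Fin n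

addMod : {n : ℕ} → ℕ → Fin n → Fin n
addMod {zero}  k ()
addMod {suc n} k j = (toℕ j + k) mod (suc n)

zeroOf : {m : ℕ} → Fin m → Fin m
zeroOf {suc m} _ = Fin.zero

-- U(i,j) = (i+1,j) for i < m (1-indexed), U(m,j) = (1, n+1-j)
Umap : {m n : ℕ} → Vertex m n → Vertex m n
Umap {m} {n} (i , j) with suc (toℕ i) <? m
... | yes p = (fromℕ< p , j)
... | no _  = (zeroOf i , opposite j)

Hmap : {m n : ℕ} → Vertex m n → Vertex m n
Hmap {m} {n} (i , j) = (i , addMod (n / 2) j)

Fmap : {m n : ℕ} → Vertex m n → Vertex m n
Fmap (i , j) = (i , opposite j)

Rmap : {m n : ℕ} → Vertex m n → Vertex m n
Rmap (i , j) = (i , addMod 1 j)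

-- KBLS(m,n) = ⟨U,H,F⟩ : the maps generated by U, H, F under composition
-- (the group is finite, so the generated monoid equals the generated group).
data InKBLS {m n : ℕ} : (Vertex m n → Vertex m n) → Set where
  kb-id : InKBLS id
  kb-U  : ∀ {A} → InKBLS A → InKBLS (Umap ∘ A)
  kb-H  : ∀ {A} → InKBLS A → InKBLS (Hmap ∘ A)
  kb-F  : ∀ {A} → InKBLS A → InKBLS (Fmap ∘ A)

-- A labeling: bijection from vertices onto {1,…,mn}, encoded as a bijection
-- onto Fin (m * n), the label of v being 1 + toℕ (to v).
Labeling : ℕ → ℕ → Set
Labeling m n = Vertex m n ⤖ Fin (m * n)

label : {m n : ℕ} → Labeling m n → Vertex m n → ℕ
label X v = suc (toℕ (Bijection.to X v))

-- For i < m-1 this is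
-- {(i,j),(i,j+1),(i+1,j),(i+1,j+1)}; for i = m-1 it is
-- {(m-1,j),(m-1,j+1),(0,n-1-j),(0,n-2-j)}, exactly the paper's faces.
faceSum : {m n : ℕ} → Labeling m n → Vertex m n → ℕ
faceSum X v = label X v + label X (Rmap v) + label X (Umap v) + label X (Umap (Rmap v))

FaceMagic : {m n : ℕ} → Labeling m n → Set
FaceMagic {m} {n} X = Σ ℕ λ k → (v : Vertex m n) → faceSum X v ≡ k

KBEquivalent : {m n : ℕ} → Labeling m n → Labeling m n → Set
KBEquivalent {m} {n} X X' =
  Σ (Vertex m n → Vertex m n) λ A → InKBLS A × ((v : Vertex m n) → label X' v ≡ label X (A v))

AtLeastNonequivMagic : ℕ → ℕ → ℕ → Set
AtLeastNonequivMagic m n K =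
  Σ (Fin K → Labeling m n) λ L →
    ((a : Fin K) → FaceMagic (L a)) ×
    ((a b : Fin K) → KBEquivalent (L a) (L b) → a ≡ b)

module Submission where

-- Write m = m′ + 1 with m′ even and n = 2h.  A vertex (i , j) gets three digits: the row
-- digit π i, the sign σ i + parity j, and the column digit e (rank j), reflected on the odd
-- squares of the checkerboard; here rank j = ⌊j/2⌋ for even j and rank j = rank (n-1-j).
-- Read in one of four mixed-radix orders these digits label the grid bijectively, with
-- label = offset (row digit , sign) + scale * column digit.  Horizontal neighbours have
-- complementary signs and vertical neighbours complementary column digits (across the
-- twisted edge too, as it joins the rows m-1 and 0 of equal parity because m is odd), so all
-- faces have the same sum.  Taking π 0 = 0, σ 0 = 0 and three choices of e gives
-- 4 * 3 * 2^(m-1) * (m-1)! labelings.  A Klein bottle symmetry shifts the rows cyclically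
-- and acts on columns by reflections and the half turn.  Label 1 lies in row 0 of every
-- labeling, so an equivalence preserves all rows.  It cannot involve the half turn, which
-- swaps the even columns of rank 0 and ⌊h/2⌋ while every choice of e increases on them, so it
-- is the identity: row 0 then determines the scale (hence the layout) and e, and the other
-- rows determine π and σ.  The count 6 * 2^m * (m-1)! also covers the case n ≡ 0 (mod 4).

open import Defs
open import Algebra.Definitions using (Involutive)
open import Data.Empty using (⊥; ⊥-elim)
open import Data.Fin using (Fin; toℕ; opposite; cast; combine; remQuot; fromℕ; fromℕ<; inject≤; punchIn; _≟_)
open import Data.Fin.Patterns using (0F; 1F; 2F; 3F)
open import Data.Fin.Permutation as Perm
  using (Permutation′; _⟨$⟩ʳ_; _⟨$⟩ˡ_; inverseˡ; inverseʳ; insert; insert-punchIn; lift₀; transpose; _∘ₚ_)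
open import Data.Fin.Properties
  using ( toℕ-injective; toℕ-combine; toℕ-cast; toℕ-fromℕ<; toℕ-fromℕ; toℕ<n; toℕ≤pred[n]; opposite-prop
        ; opposite-involutive; combine-remQuot; inject≤-injective; punchIn-injective; *↔×)
import Data.Fin.Properties as Finₚ
open import Data.Nat
  using ( ℕ; zero; suc; _+_; _*_; _∸_; _^_; _!; _%_; _/_; _≤_; _<_; z≤n; s≤s; s≤s⁻¹; z<s; s<s; _<?_
        ; NonZero; parity; ⌊_/2⌋)
open import Data.Nat.Divisibility using (_∣_; ∣-antisym; m∣m*n)
open import Data.Nat.DivMod using (m≡m%n+[m/n]*n; [m+kn]%n≡m%n; [m+n]%n≡m%n; m<n⇒m%n≡m; %-distribˡ-+; m%n%n≡m%n; m*n/n≡m)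
open import Data.Nat.Properties hiding (_≟_)
open import Data.Nat.Tactic.RingSolver using (solve-∀)
open import Data.Parity.Base as ℙ using (Parity; 0ℙ; 1ℙ; _⁻¹)
import Data.Parity.Properties as ℙₚ
open import Data.Product using (_×_; _,_; proj₁; proj₂; Σ; uncurry)
open import Data.Product.Function.NonDependent.Propositional using (_×-↔_)
open import Data.Product.Properties using (×-≡,≡→≡)
open import Data.Vec.Functional using (_∷_)
open import Function.Base using (id; _∘_)
open import Function.Bundles using (_↔_; _↣_; Inverse; Injection; Bijection; mk↔ₛ′)
open import Function.Construct.Composition using (_↔-∘_)
open import Function.Construct.Identity using (↔-id)
open import Function.Construct.Symmetry using (↔-sym)
open import Function.Properties.Inverse using (↔⇒↣; ↔⇒⤖)
open import Relation.Binary.PropositionalEquality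
open import Relation.Nullary using (yes; no)
open import Relation.Nullary.Decidable using (dec-true; dec-false)

suc-toℕ+toℕ-opposite : ∀ {n} (i : Fin n) → suc (toℕ i + toℕ (opposite i)) ≡ n
suc-toℕ+toℕ-opposite {suc n} i = cong suc (begin
  toℕ i + toℕ (opposite i) ≡⟨ cong (toℕ i +_) (opposite-prop i) ⟩
  toℕ i + (n ∸ toℕ i)      ≡⟨ m+[n∸m]≡n (toℕ≤pred[n] i) ⟩
  n                        ∎)
  where open ≡-Reasoning

opposite-unique : ∀ {n} (i j : Fin n) → suc (toℕ i + toℕ j) ≡ n → opposite i ≡ j
opposite-unique i j eq =
  toℕ-injective (+-cancelˡ-≡ (suc (toℕ i)) _ _ (trans (suc-toℕ+toℕ-opposite i) (sym eq)))

combine-opposite : ∀ {a b} (i : Fin a) (j : Fin b) →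
                   combine (opposite i) (opposite j) ≡ opposite (combine i j)
combine-opposite {a} {b} i j = sym (opposite-unique (combine i j) _ (begin
  suc (toℕ (combine i j) + toℕ (combine (opposite i) (opposite j)))
    ≡⟨ cong₂ (λ u v → suc (u + v)) (toℕ-combine i j) (toℕ-combine (opposite i) (opposite j)) ⟩
  suc (b * x + y + (b * x′ + y′))  ≡⟨ regroup b x x′ y y′ ⟩
  suc (y + y′) + b * (x + x′)      ≡⟨ cong (_+ b * (x + x′)) (suc-toℕ+toℕ-opposite j) ⟩
  b + b * (x + x′)                 ≡⟨ *-suc b (x + x′) ⟨
  b * suc (x + x′)                 ≡⟨ cong (b *_) (suc-toℕ+toℕ-opposite i) ⟩
  b * a                            ≡⟨ *-comm b a ⟩
  a * b                            ∎))
  where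
  open ≡-Reasoning
  x x′ y y′ : ℕ
  x = toℕ i
  x′ = toℕ (opposite i)
  y = toℕ j
  y′ = toℕ (opposite j)
  regroup : ∀ b x x′ y y′ → suc (b * x + y + (b * x′ + y′)) ≡ suc (y + y′) + b * (x + x′)
  regroup = solve-∀

cast-opposite : ∀ {a b} (eq : a ≡ b) (i : Fin a) → cast eq (opposite i) ≡ opposite (cast eq i)
cast-opposite {a} {b} eq i = sym (opposite-unique (cast eq i) _ (begin
  suc (toℕ (cast eq i) + toℕ (cast eq (opposite i)))
    ≡⟨ cong₂ (λ u v → suc (u + v)) (toℕ-cast eq i) (toℕ-cast eq (opposite i)) ⟩
  suc (toℕ i + toℕ (opposite i)) ≡⟨ suc-toℕ+toℕ-opposite i ⟩
  a                              ≡⟨ eq ⟩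
  b                              ∎))
  where open ≡-Reasoning

remQuot-injective : ∀ {a} b {c c′ : Fin (a * b)} → remQuot {a} b c ≡ remQuot b c′ → c ≡ c′
remQuot-injective {a} b {c} {c′} eq = begin
  c                                  ≡⟨ combine-remQuot {a} b c ⟨
  uncurry combine (remQuot {a} b c)  ≡⟨ cong (uncurry combine) eq ⟩
  uncurry combine (remQuot {a} b c′) ≡⟨ combine-remQuot {a} b c′ ⟩
  c′                                 ∎
  where open ≡-Reasoning

*↔×₄ : ∀ {a b c d} → Fin (a * b * c * d) ↔ (((Fin a × Fin b) × Fin c) × Fin d)
*↔×₄ = ((*↔× ×-↔ ↔-id _) ×-↔ ↔-id _) ↔-∘ ((*↔× ×-↔ ↔-id _) ↔-∘ *↔×)

transpose-matchˡ : ∀ {n} (i j : Fin n) → transpose i j ⟨$⟩ʳ i ≡ j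
transpose-matchˡ i j rewrite dec-true (i ≟ i) refl = refl

transpose-matchʳ : ∀ {n} (i j : Fin n) → transpose i j ⟨$⟩ʳ j ≡ i
transpose-matchʳ i j with j ≟ i
... | yes j≡i = j≡i
... | no _ rewrite dec-true (j ≟ j) refl = refl

transpose-other : ∀ {n} {i j k : Fin n} → k ≢ i → k ≢ j → transpose i j ⟨$⟩ʳ k ≡ k
transpose-other {i = i} {j} {k} k≢i k≢j rewrite dec-false (k ≟ i) k≢i | dec-false (k ≟ j) k≢j = refl

iterᵖ : ∀ {A : Set} → Parity → (A → A) → A → A
iterᵖ 0ℙ f = id
iterᵖ 1ℙ f = f

iterᵖ-⁻¹ : ∀ {A : Set} {f : A → A} → Involutive _≡_ f → ∀ p x → iterᵖ (p ⁻¹) f x ≡ f (iterᵖ p f x)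
iterᵖ-⁻¹ inv 0ℙ x = refl
iterᵖ-⁻¹ inv 1ℙ x = sym (inv x)

iterᵖ-involutive : ∀ {A : Set} {f : A → A} → Involutive _≡_ f → ∀ p → Involutive _≡_ (iterᵖ p f)
iterᵖ-involutive inv 0ℙ x = refl
iterᵖ-involutive inv 1ℙ x = inv x

iterᵖ-comm : ∀ {A : Set} {f g : A → A} → (∀ x → f (g x) ≡ g (f x)) →
             ∀ p x → iterᵖ p f (g x) ≡ g (iterᵖ p f x)
iterᵖ-comm comm 0ℙ x = refl
iterᵖ-comm comm 1ℙ x = comm x

p+q≡1ℙ⇒q≡p⁻¹ : ∀ p q → p ℙ.+ q ≡ 1ℙ → q ≡ p ⁻¹
p+q≡1ℙ⇒q≡p⁻¹ 0ℙ 1ℙ _ = refl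
p+q≡1ℙ⇒q≡p⁻¹ 1ℙ 0ℙ _ = refl

p+q≡0ℙ⇒q≡p : ∀ p q → p ℙ.+ q ≡ 0ℙ → q ≡ p
p+q≡0ℙ⇒q≡p 0ℙ 0ℙ _ = refl
p+q≡0ℙ⇒q≡p 1ℙ 1ℙ _ = refl

p+q⁻¹≡[p+q]⁻¹ : ∀ p q → p ℙ.+ q ⁻¹ ≡ (p ℙ.+ q) ⁻¹
p+q⁻¹≡[p+q]⁻¹ 0ℙ q = refl
p+q⁻¹≡[p+q]⁻¹ 1ℙ q = refl

p⁻¹+q≡[p+q]⁻¹ : ∀ p q → p ⁻¹ ℙ.+ q ≡ (p ℙ.+ q) ⁻¹
p⁻¹+q≡[p+q]⁻¹ 0ℙ q = refl
p⁻¹+q≡[p+q]⁻¹ 1ℙ q = sym (ℙₚ.⁻¹-involutive q)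

p+[p+q]≡q : ∀ p q → p ℙ.+ (p ℙ.+ q) ≡ q
p+[p+q]≡q 0ℙ q = refl
p+[p+q]≡q 1ℙ q = ℙₚ.⁻¹-involutive q

parity-suc : ∀ k → parity (suc k) ≡ parity k ⁻¹
parity-suc k = trans (sym (ℙₚ.⁻¹-involutive _)) (cong _⁻¹ (ℙₚ.suc-homo-⁻¹ k))

parity-double : ∀ k → parity (k + k) ≡ 0ℙ
parity-double k = trans (ℙₚ.+-homo-+ k k) (ℙₚ.p+p≡0ℙ (parity k))

parity-opposite : ∀ {n} → parity n ≡ 0ℙ → (i : Fin n) → parity (toℕ (opposite i)) ≡ parity (toℕ i) ⁻¹
parity-opposite {n} even i = p+q≡1ℙ⇒q≡p⁻¹ _ _ (begin
  parity (toℕ i) ℙ.+ parity (toℕ (opposite i)) ≡⟨ ℙₚ.+-homo-+ (toℕ i) _ ⟨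
  parity (toℕ i + toℕ (opposite i))            ≡⟨ ℙₚ.suc-homo-⁻¹ (toℕ i + toℕ (opposite i)) ⟨
  parity (suc (toℕ i + toℕ (opposite i))) ⁻¹   ≡⟨ cong (λ k → parity k ⁻¹) (suc-toℕ+toℕ-opposite i) ⟩
  parity n ⁻¹                                  ≡⟨ cong _⁻¹ even ⟩
  1ℙ                                           ∎)
  where open ≡-Reasoning

parity-% : ∀ {n} .{{_ : NonZero n}} → parity n ≡ 0ℙ → ∀ x → parity (x % n) ≡ parity x
parity-% {n} even x = sym (begin
  parity x                                          ≡⟨ cong parity (m≡m%n+[m/n]*n x n) ⟩
  parity (x % n + x / n * n)                        ≡⟨ ℙₚ.+-homo-+ (x % n) _ ⟩
  parity (x % n) ℙ.+ parity (x / n * n)             ≡⟨ cong (parity (x % n) ℙ.+_) (ℙₚ.*-homo-* (x / n) n) ⟩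
  parity (x % n) ℙ.+ (parity (x / n) ℙ.* parity n) ≡⟨ cong (λ p → parity (x % n) ℙ.+ (parity (x / n) ℙ.* p)) even ⟩
  parity (x % n) ℙ.+ (parity (x / n) ℙ.* 0ℙ)        ≡⟨ cong (parity (x % n) ℙ.+_) (ℙₚ.*-zeroʳ _) ⟩
  parity (x % n) ℙ.+ 0ℙ                             ≡⟨ ℙₚ.+-identityʳ _ ⟩
  parity (x % n)                                    ∎)
  where open ≡-Reasoning

parity-odd : ∀ k → k % 2 ≡ 1 → parity k ≡ 1ℙ
parity-odd k odd = trans (sym (parity-% refl k)) (cong parity odd)

halves : ∀ k → iterᵖ (parity k) suc (⌊ k /2⌋ + ⌊ k /2⌋) ≡ k
halves zero          = refl
halves (suc zero)    = refl
halves (suc (suc k)) = begin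
  iterᵖ (parity k) suc (suc q + suc q)     ≡⟨ cong (iterᵖ (parity k) suc ∘ suc) (+-suc q q) ⟩
  iterᵖ (parity k) suc (suc (suc (q + q))) ≡⟨ iterᵖ-comm {g = suc} (λ _ → refl) (parity k) (suc (q + q)) ⟩
  suc (iterᵖ (parity k) suc (suc (q + q))) ≡⟨ cong suc (iterᵖ-comm {g = suc} (λ _ → refl) (parity k) (q + q)) ⟩
  suc (suc (iterᵖ (parity k) suc (q + q))) ≡⟨ cong (suc ∘ suc) (halves k) ⟩
  suc (suc k)                              ∎
  where
  open ≡-Reasoning
  q : ℕ
  q = ⌊ k /2⌋

divMod-unique : ∀ {m a c} k l .{{_ : NonZero m}} → a < m → c < m → a + k * m ≡ c + l * m → a ≡ c × k ≡ l
divMod-unique {m} {a} {c} k l a<m c<m eq =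
  a≡c , *-cancelʳ-≡ k l m (+-cancelˡ-≡ a _ _ (trans eq (cong (_+ l * m) (sym a≡c))))
  where
  open ≡-Reasoning
  a≡c : a ≡ c
  a≡c = begin
    a               ≡⟨ m<n⇒m%n≡m a<m ⟨
    a % m           ≡⟨ [m+kn]%n≡m%n a k m ⟨
    (a + k * m) % m ≡⟨ cong (_% m) eq ⟩
    (c + l * m) % m ≡⟨ [m+kn]%n≡m%n c l m ⟩
    c % m           ≡⟨ m<n⇒m%n≡m c<m ⟩
    c               ∎

[m%n+k]%n≡[m+k]%n : ∀ a b n .{{_ : NonZero n}} → (a % n + b) % n ≡ (a + b) % n
[m%n+k]%n≡[m+k]%n a b n = begin
  (a % n + b) % n         ≡⟨ %-distribˡ-+ (a % n) b n ⟩
  (a % n % n + b % n) % n ≡⟨ cong (λ x → (x + b % n) % n) (m%n%n≡m%n a n) ⟩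
  (a % n + b % n) % n     ≡⟨ %-distribˡ-+ a b n ⟨
  (a + b) % n             ∎
  where open ≡-Reasoning

⌊n/2⌋-bounds : ∀ k → 3 ≤ k → 0 < ⌊ k /2⌋ × suc ⌊ k /2⌋ < k
⌊n/2⌋-bounds (suc (suc (suc r))) (s≤s (s≤s (s≤s z≤n))) = z<s , s<s (s<s (⌊n/2⌋<n r))

even⇒double : ∀ n → n % 2 ≡ 0 → n ≡ n / 2 + n / 2
even⇒double n even = begin
  n                   ≡⟨ m≡m%n+[m/n]*n n 2 ⟩
  n % 2 + n / 2 * 2   ≡⟨ cong (_+ n / 2 * 2) even ⟩
  n / 2 * 2           ≡⟨ *-comm (n / 2) 2 ⟩
  n / 2 + (n / 2 + 0) ≡⟨ cong (n / 2 +_) (+-identityʳ (n / 2)) ⟩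
  n / 2 + n / 2       ∎
  where open ≡-Reasoning

double-≥6 : ∀ h → 6 ≤ h + h → Σ ℕ λ h′ → 2 ≤ h′ × h ≡ suc h′
double-≥6 (suc (suc (suc r))) _ = suc (suc r) , s≤s (s≤s z≤n) , refl
double-≥6 0 ()
double-≥6 1 (s≤s (s≤s ()))
double-≥6 2 (s≤s (s≤s (s≤s (s≤s ()))))

even-split : ∀ n → n % 2 ≡ 0 → 6 ≤ n → Σ ℕ λ h′ → 2 ≤ h′ × n ≡ suc h′ + suc h′
even-split n even 6≤n with double-≥6 (n / 2) (subst (6 ≤_) (even⇒double n even) 6≤n)
... | h′ , h′≥2 , h≡ = h′ , h′≥2 , trans (even⇒double n even) (cong₂ _+_ h≡ h≡)

-- Codes for permutations and sign vectors

lehmer : ∀ k → Fin (k !) → Permutation′ k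
lehmer zero    _ = Perm.id
lehmer (suc k) c = insert 0F (proj₁ (remQuot {suc k} (k !) c)) (lehmer k (proj₂ (remQuot {suc k} (k !) c)))

lehmer-injective : ∀ k {c c′} → (∀ i → lehmer k c ⟨$⟩ʳ i ≡ lehmer k c′ ⟨$⟩ʳ i) → c ≡ c′
lehmer-injective zero    {0F} {0F} _ = refl
lehmer-injective (suc k) {c} {c′} same =
  remQuot-injective {suc k} (k !) (×-≡,≡→≡ (j≡j′ , lehmer-injective k tails))
  where
  open ≡-Reasoning
  j j′ : Fin (suc k)
  j = proj₁ (remQuot {suc k} (k !) c)
  j′ = proj₁ (remQuot {suc k} (k !) c′)
  π π′ : Permutation′ k
  π = lehmer k (proj₂ (remQuot {suc k} (k !) c))
  π′ = lehmer k (proj₂ (remQuot {suc k} (k !) c′))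
  j≡j′ : j ≡ j′
  j≡j′ = same 0F
  tails : ∀ i → π ⟨$⟩ʳ i ≡ π′ ⟨$⟩ʳ i
  tails i = punchIn-injective j _ _ (begin
    punchIn j (π ⟨$⟩ʳ i)               ≡⟨ insert-punchIn 0F j π i ⟨
    lehmer (suc k) c ⟨$⟩ʳ Fin.suc i    ≡⟨ same (Fin.suc i) ⟩
    lehmer (suc k) c′ ⟨$⟩ʳ Fin.suc i   ≡⟨ insert-punchIn 0F j′ π′ i ⟩
    punchIn j′ (π′ ⟨$⟩ʳ i)             ≡⟨ cong (λ x → punchIn x (π′ ⟨$⟩ʳ i)) j≡j′ ⟨
    punchIn j (π′ ⟨$⟩ʳ i)              ∎)

bit : Fin 2 → Parity
bit 0F = 0ℙ
bit 1F = 1ℙ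

bit-injective : ∀ {x y} → bit x ≡ bit y → x ≡ y
bit-injective {0F} {0F} _ = refl
bit-injective {0F} {1F} ()
bit-injective {1F} {0F} ()
bit-injective {1F} {1F} _ = refl

signs : ∀ k → Fin (2 ^ k) → Fin k → Parity
signs (suc k) c 0F          = bit (proj₁ (remQuot {2} (2 ^ k) c))
signs (suc k) c (Fin.suc i) = signs k (proj₂ (remQuot {2} (2 ^ k) c)) i

signs-injective : ∀ k {c c′} → (∀ i → signs k c i ≡ signs k c′ i) → c ≡ c′
signs-injective zero    {0F} {0F} _ = refl
signs-injective (suc k) same =
  remQuot-injective {2} (2 ^ k) (×-≡,≡→≡ (bit-injective (same 0F) , signs-injective k (same ∘ Fin.suc)))

-- Counting labelings and face sums

AtLeastNonequivMagic-↣ : ∀ {m n K} {C : Set} (code : Fin K ↣ C) (L : C → Labeling m n) →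
                         (∀ c → FaceMagic (L c)) → (∀ c c′ → KBEquivalent (L c) (L c′) → c ≡ c′) →
                         AtLeastNonequivMagic m n K
AtLeastNonequivMagic-↣ code L magic distinct =
  L ∘ to , magic ∘ to , λ a b equivalent → injective (distinct (to a) (to b) equivalent)
  where open Injection code

AtLeastNonequivMagic-≤ : ∀ {m n K K′} → K′ ≤ K → AtLeastNonequivMagic m n K → AtLeastNonequivMagic m n K′
AtLeastNonequivMagic-≤ le (L , magic , distinct) =
  L ∘ (λ a → inject≤ a le) , magic ∘ (λ a → inject≤ a le) ,
  λ a b equivalent → inject≤-injective le le a b (distinct _ _ equivalent)

faceMagic-split : ∀ {m n} (X : Labeling m n) (a b : Vertex m n → ℕ) (s A B : ℕ) →
                  (∀ v → label X v ≡ suc (a v + s * b v)) →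
                  (∀ v → a v + a (Rmap v) ≡ A) →
                  (∀ v → a (Umap v) + a (Umap (Rmap v)) ≡ A) →
                  (∀ v → b v + b (Umap v) ≡ B) →
                  FaceMagic X
faceMagic-split X a b s A B split right upRight up = A + A + s * (B + B) + 4 , λ v → begin
  faceSum X v
    ≡⟨ cong₂ _+_ (cong₂ _+_ (cong₂ _+_ (split v) (split (Rmap v))) (split (Umap v))) (split (Umap (Rmap v))) ⟩
  suc (a v + s * b v) + suc (a (Rmap v) + s * b (Rmap v)) + suc (a (Umap v) + s * b (Umap v))
    + suc (a (Umap (Rmap v)) + s * b (Umap (Rmap v)))
    ≡⟨ regroup (a v) (a (Rmap v)) (a (Umap v)) (a (Umap (Rmap v))) (b v) (b (Rmap v)) (b (Umap v)) (b (Umap (Rmap v))) s ⟩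
  (a v + a (Rmap v)) + (a (Umap v) + a (Umap (Rmap v))) + s * ((b v + b (Umap v)) + (b (Rmap v) + b (Umap (Rmap v)))) + 4
    ≡⟨ cong₂ (λ x y → x + y + 4) (cong₂ _+_ (right v) (upRight v)) (cong (s *_) (cong₂ _+_ (up v) (up (Rmap v)))) ⟩
  A + A + s * (B + B) + 4 ∎
  where
  open ≡-Reasoning
  regroup : ∀ a₁ a₂ a₃ a₄ b₁ b₂ b₃ b₄ s →
            suc (a₁ + s * b₁) + suc (a₂ + s * b₂) + suc (a₃ + s * b₃) + suc (a₄ + s * b₄) ≡
            (a₁ + a₂) + (a₃ + a₄) + s * ((b₁ + b₃) + (b₂ + b₄)) + 4
  regroup = solve-∀

module Grid (m′ h′ : ℕ) where

  m h n : ℕ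
  m = suc m′
  h = suc h′
  n = h + h

  h*2≡n : h * 2 ≡ n
  h*2≡n = trans (*-comm h 2) (cong (h +_) (+-identityʳ h))

  digits↔ : (Fin h × Fin 2) ↔ (Parity × Fin h)
  digits↔ = mk↔ₛ′ to from to-from from-to
    where
    to : Fin h × Fin 2 → Parity × Fin h
    to (t , 0F) = 0ℙ , t
    to (t , 1F) = 1ℙ , opposite t
    from : Parity × Fin h → Fin h × Fin 2
    from (0ℙ , t) = t , 0F
    from (1ℙ , t) = opposite t , 1F
    to-from : ∀ x → to (from x) ≡ x
    to-from (0ℙ , t) = refl
    to-from (1ℙ , t) = cong (1ℙ ,_) (opposite-involutive t)
    from-to : ∀ x → from (to x) ≡ x
    from-to (t , 0F) = refl
    from-to (t , 1F) = cong (_, 1F) (opposite-involutive t)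

  -- Column 2t is coded (0ℙ , t) and column 2t+1 is coded (1ℙ , h-1-t), so that opposite
  -- only changes the parity (col-opposite).
  columns : Fin n ↔ (Parity × Fin h)
  columns = digits↔ ↔-∘ (*↔× ↔-∘ Perm.cast-id (sym h*2≡n))

  col : Parity → Fin h → Fin n
  col p t = Inverse.from columns (p , t)

  side : Fin n → Parity
  side = proj₁ ∘ Inverse.to columns

  rank : Fin n → Fin h
  rank = proj₂ ∘ Inverse.to columns

  col-side-rank : ∀ j → col (side j) (rank j) ≡ j
  col-side-rank = Inverse.strictlyInverseʳ columns

  side-col : ∀ p t → side (col p t) ≡ p
  side-col p t = cong proj₁ (Inverse.strictlyInverseˡ columns (p , t))

  rank-col : ∀ p t → rank (col p t) ≡ t
  rank-col p t = cong proj₂ (Inverse.strictlyInverseˡ columns (p , t))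

  col-opposite : ∀ p t → col (p ⁻¹) t ≡ opposite (col p t)
  col-opposite 0ℙ t = begin
    cast _ (combine (opposite t) 1F) ≡⟨ cong (cast _) (combine-opposite t 0F) ⟩
    cast _ (opposite (combine t 0F)) ≡⟨ cast-opposite h*2≡n (combine t 0F) ⟩
    opposite (cast _ (combine t 0F)) ∎
    where open ≡-Reasoning
  col-opposite 1ℙ t = begin
    col 0ℙ t                       ≡⟨ opposite-involutive _ ⟨
    opposite (opposite (col 0ℙ t)) ≡⟨ cong opposite (col-opposite 0ℙ t) ⟨
    opposite (col 1ℙ t)            ∎
    where open ≡-Reasoning

  opposite-col : ∀ j → opposite j ≡ col (side j ⁻¹) (rank j)
  opposite-col j = trans (cong opposite (sym (col-side-rank j))) (sym (col-opposite (side j) (rank j)))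

  side-opposite : ∀ j → side (opposite j) ≡ side j ⁻¹
  side-opposite j = trans (cong side (opposite-col j)) (side-col (side j ⁻¹) (rank j))

  rank-opposite : ∀ j → rank (opposite j) ≡ rank j
  rank-opposite j = trans (cong rank (opposite-col j)) (rank-col (side j ⁻¹) (rank j))

  n-even : parity n ≡ 0ℙ
  n-even = parity-double h

  toℕ-col0 : ∀ t → toℕ (col 0ℙ t) ≡ 2 * toℕ t + 0
  toℕ-col0 t = trans (toℕ-cast _ (combine t 0F)) (toℕ-combine t 0F)

  parity-col : ∀ p t → parity (toℕ (col p t)) ≡ p
  parity-col 0ℙ t = begin
    parity (toℕ (col 0ℙ t))   ≡⟨ cong parity (toℕ-col0 t) ⟩
    parity (2 * toℕ t + 0)    ≡⟨ ℙₚ.+-homo-+ (2 * toℕ t) 0 ⟩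
    parity (2 * toℕ t) ℙ.+ 0ℙ ≡⟨ cong (ℙ._+ 0ℙ) (ℙₚ.*-homo-* 2 (toℕ t)) ⟩
    0ℙ                        ∎
    where open ≡-Reasoning
  parity-col 1ℙ t = begin
    parity (toℕ (col 1ℙ t))            ≡⟨ cong (parity ∘ toℕ) (col-opposite 0ℙ t) ⟩
    parity (toℕ (opposite (col 0ℙ t))) ≡⟨ parity-opposite n-even (col 0ℙ t) ⟩
    parity (toℕ (col 0ℙ t)) ⁻¹         ≡⟨ cong _⁻¹ (parity-col 0ℙ t) ⟩
    1ℙ                                 ∎
    where open ≡-Reasoning

  side≡parity : ∀ j → side j ≡ parity (toℕ j)
  side≡parity j = trans (sym (parity-col (side j) (rank j))) (cong (parity ∘ toℕ) (col-side-rank j))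

  toℕ-addMod : ∀ k j → toℕ (addMod k j) ≡ (toℕ j + k) % n
  toℕ-addMod k j = toℕ-fromℕ< _

  side-addMod : ∀ k j → side (addMod k j) ≡ side j ℙ.+ parity k
  side-addMod k j = begin
    side (addMod k j)           ≡⟨ side≡parity (addMod k j) ⟩
    parity (toℕ (addMod k j))   ≡⟨ cong parity (toℕ-addMod k j) ⟩
    parity ((toℕ j + k) % n)    ≡⟨ parity-% n-even (toℕ j + k) ⟩
    parity (toℕ j + k)          ≡⟨ ℙₚ.+-homo-+ (toℕ j) k ⟩
    parity (toℕ j) ℙ.+ parity k ≡⟨ cong (ℙ._+ parity k) (side≡parity j) ⟨
    side j ℙ.+ parity k         ∎
    where open ≡-Reasoning

  side-right : ∀ j → side (addMod 1 j) ≡ side j ⁻¹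
  side-right j = trans (side-addMod 1 j) (ℙₚ.+-comm (side j) 1ℙ)

  halfTurn : Fin n → Fin n
  halfTurn = addMod (n / 2)

  n/2≡h : n / 2 ≡ h
  n/2≡h = trans (cong (_/ 2) (sym h*2≡n)) (m*n/n≡m h 2)

  toℕ-halfTurn : ∀ j → toℕ (halfTurn j) ≡ (toℕ j + h) % n
  toℕ-halfTurn j = trans (toℕ-addMod (n / 2) j) (cong (λ k → (toℕ j + k) % n) n/2≡h)

  side-halfTurn : ∀ j → side (halfTurn j) ≡ side j ℙ.+ parity h
  side-halfTurn j = trans (side-addMod (n / 2) j) (cong (λ k → side j ℙ.+ parity k) n/2≡h)

  halfTurn-involutive : ∀ j → halfTurn (halfTurn j) ≡ j
  halfTurn-involutive j = toℕ-injective (begin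
    toℕ (halfTurn (halfTurn j)) ≡⟨ toℕ-halfTurn (halfTurn j) ⟩
    (toℕ (halfTurn j) + h) % n  ≡⟨ cong (λ x → (x + h) % n) (toℕ-halfTurn j) ⟩
    ((toℕ j + h) % n + h) % n   ≡⟨ [m%n+k]%n≡[m+k]%n (toℕ j + h) h n ⟩
    (toℕ j + h + h) % n         ≡⟨ cong (_% n) (+-assoc (toℕ j) h h) ⟩
    (toℕ j + n) % n             ≡⟨ [m+n]%n≡m%n (toℕ j) n ⟩
    toℕ j % n                   ≡⟨ m<n⇒m%n≡m (toℕ<n j) ⟩
    toℕ j                       ∎)
    where open ≡-Reasoning

  -- For x = toℕ j < h the two half turns are x + h and (n - 1 - x) + h - n = h - 1 - x.
  halfTurn-complement : ∀ j → toℕ j < h → suc (toℕ (halfTurn j) + toℕ (halfTurn (opposite j))) ≡ n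
  halfTurn-complement j x<h = begin
    suc (toℕ (halfTurn j) + toℕ (halfTurn (opposite j)))
      ≡⟨ cong₂ (λ a b → suc (a + b)) (toℕ-halfTurn j) (toℕ-halfTurn (opposite j)) ⟩
    suc ((x + h) % n + (toℕ (opposite j) + h) % n)
      ≡⟨ cong₂ (λ a b → suc (a + b % n)) (m<n⇒m%n≡m x+h<n) opposite+h ⟩
    suc (x + h + (d + n) % n)
      ≡⟨ cong (λ a → suc (x + h + a)) (trans ([m+n]%n≡m%n d n) (m<n⇒m%n≡m d<n)) ⟩
    suc (x + h + d) ≡⟨ regroup x h d ⟩
    h + (suc x + d) ≡⟨ cong (h +_) (m+[n∸m]≡n x<h) ⟩
    n               ∎
    where
    open ≡-Reasoning
    x d : ℕ
    x = toℕ j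
    d = h ∸ suc x
    x+h<n : x + h < n
    x+h<n = +-monoˡ-< h x<h
    d<n : d < n
    d<n = s≤s (≤-trans (m∸n≤m h (suc x)) (m≤n+m h h′))
    opposite+h : toℕ (opposite j) + h ≡ d + n
    opposite+h = begin
      toℕ (opposite j) + h ≡⟨ cong (_+ h) (opposite-prop j) ⟩
      (h + h) ∸ suc x + h  ≡⟨ cong (_+ h) (+-∸-comm h x<h) ⟩
      d + h + h            ≡⟨ +-assoc d h h ⟩
      d + n                ∎
    regroup : ∀ x h d → suc (x + h + d) ≡ h + (suc x + d)
    regroup = solve-∀

  halfTurn-opposite : ∀ j → halfTurn (opposite j) ≡ opposite (halfTurn j)
  halfTurn-opposite j with toℕ j <? h
  ... | yes x<h = sym (opposite-unique (halfTurn j) _ (halfTurn-complement j x<h))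
  ... | no x≮h = begin
    halfTurn (opposite j)                       ≡⟨ opposite-involutive _ ⟨
    opposite (opposite (halfTurn (opposite j))) ≡⟨ cong opposite (opposite-unique (halfTurn (opposite j)) _ complement) ⟩
    opposite (halfTurn (opposite (opposite j))) ≡⟨ cong (opposite ∘ halfTurn) (opposite-involutive j) ⟩
    opposite (halfTurn j)                       ∎
    where
    open ≡-Reasoning
    opposite<h : toℕ (opposite j) < h
    opposite<h = +-cancelˡ-< h _ _ (subst (h + toℕ (opposite j) <_) (suc-toℕ+toℕ-opposite j)
                                       (s≤s (+-monoˡ-≤ (toℕ (opposite j)) (≮⇒≥ x≮h))))
    complement : suc (toℕ (halfTurn (opposite j)) + toℕ (halfTurn (opposite (opposite j)))) ≡ n
    complement = halfTurn-complement (opposite j) opposite<h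

  mid : Fin h
  mid = fromℕ< (⌊n/2⌋<n h′)

  toℕ-mid : toℕ mid ≡ ⌊ h /2⌋
  toℕ-mid = toℕ-fromℕ< (⌊n/2⌋<n h′)

  halfTurn-col0 : iterᵖ (parity h) opposite (halfTurn (col 0ℙ 0F)) ≡ col 0ℙ mid
  halfTurn-col0 = toℕ-injective (trans (lhs (parity h) (halves h)) (sym rhs))
    where
    open ≡-Reasoning
    q : ℕ
    q = ⌊ h /2⌋
    toℕ-halfTurn-col0 : toℕ (halfTurn (col 0ℙ 0F)) ≡ h
    toℕ-halfTurn-col0 = trans (toℕ-halfTurn (col 0ℙ 0F))
                              (trans (cong (λ x → (x + h) % n) (toℕ-col0 0F)) (m<n⇒m%n≡m (m<m+n h z<s)))
    rhs : toℕ (col 0ℙ mid) ≡ q + q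
    rhs = trans (toℕ-col0 mid) (trans (cong (λ x → 2 * x + 0) toℕ-mid) (double q))
      where
      double : ∀ q → 2 * q + 0 ≡ q + q
      double = solve-∀
    lhs : ∀ p → iterᵖ p suc (q + q) ≡ h → toℕ (iterᵖ p opposite (halfTurn (col 0ℙ 0F))) ≡ q + q
    lhs 0ℙ h≡ = trans toℕ-halfTurn-col0 (sym h≡)
    lhs 1ℙ h≡ = begin
      toℕ (opposite (halfTurn (col 0ℙ 0F))) ≡⟨ opposite-prop (halfTurn (col 0ℙ 0F)) ⟩
      n ∸ suc (toℕ (halfTurn (col 0ℙ 0F)))  ≡⟨ cong (λ x → n ∸ suc x) toℕ-halfTurn-col0 ⟩
      h′ + h ∸ h                            ≡⟨ m+n∸n≡m h′ h ⟩
      h′                                    ≡⟨ suc-injective h≡ ⟨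
      q + q                                 ∎

  data UStep (i : Fin m) (j : Fin n) : Vertex m n → Set where
    up   : (p : suc (toℕ i) < m) → UStep i j (fromℕ< p , j)
    wrap : suc (toℕ i) ≡ m → UStep i j (0F , opposite j)

  uStep : ∀ i j → UStep i j (Umap (i , j))
  uStep i j with suc (toℕ i) <? m
  ... | yes p = up p
  ... | no ¬p = wrap (≤-antisym (toℕ<n i) (≮⇒≥ ¬p))

  color : Vertex m n → Parity
  color (i , j) = parity (toℕ i) ℙ.+ side j

  up-color : parity m′ ≡ 0ℙ → ∀ v → color (Umap v) ≡ color v ⁻¹
  up-color m′-even (i , j) = step (uStep i j)
    where
    step : ∀ {w} → UStep i j w → color w ≡ color (i , j) ⁻¹
    step (up p) = trans (cong (λ x → parity x ℙ.+ side j) (toℕ-fromℕ< p))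
                        (trans (cong (ℙ._+ side j) (parity-suc (toℕ i))) (p⁻¹+q≡[p+q]⁻¹ (parity (toℕ i)) (side j)))
    step (wrap last) = trans (side-opposite j) (cong (λ p → (p ℙ.+ side j) ⁻¹) (sym i-even))
      where
      i-even : parity (toℕ i) ≡ 0ℙ
      i-even = trans (cong parity (suc-injective last)) m′-even

  up-rank : ∀ v → rank (proj₂ (Umap v)) ≡ rank (proj₂ v)
  up-rank (i , j) = step (uStep i j)
    where
    step : ∀ {w} → UStep i j w → rank (proj₂ w) ≡ rank j
    step (up p)   = refl
    step (wrap _) = rank-opposite j

  up-right : ∀ v → proj₁ (Umap (Rmap v)) ≡ proj₁ (Umap v) × side (proj₂ (Umap (Rmap v))) ≡ side (proj₂ (Umap v)) ⁻¹
  up-right (i , j) = step (uStep i j) (uStep i (addMod 1 j))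
    where
    step : ∀ {w w′} → UStep i j w → UStep i (addMod 1 j) w′ →
           proj₁ w′ ≡ proj₁ w × side (proj₂ w′) ≡ side (proj₂ w) ⁻¹
    step (up p)      (up p′)     = toℕ-injective (trans (toℕ-fromℕ< p′) (sym (toℕ-fromℕ< p))) , side-right j
    step (wrap _)    (wrap _)    = refl , (begin
      side (opposite (addMod 1 j)) ≡⟨ side-opposite (addMod 1 j) ⟩
      side (addMod 1 j) ⁻¹         ≡⟨ cong _⁻¹ (side-right j) ⟩
      side j ⁻¹ ⁻¹                 ≡⟨ cong _⁻¹ (side-opposite j) ⟨
      side (opposite j) ⁻¹         ∎)
      where open ≡-Reasoning
    step (up p)      (wrap last) = ⊥-elim (<-irrefl last p)
    step (wrap last) (up p)      = ⊥-elim (<-irrefl last p)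

  colMap : Parity → Parity → Fin n → Fin n
  colMap β η = iterᵖ β opposite ∘ iterᵖ η halfTurn

  iterᵖ-opposite-halfTurn : ∀ γ j → iterᵖ γ opposite (halfTurn j) ≡ halfTurn (iterᵖ γ opposite j)
  iterᵖ-opposite-halfTurn = iterᵖ-comm {g = halfTurn} (λ x → sym (halfTurn-opposite x))

  colMap-involutive : ∀ γ η j → colMap γ η (colMap γ η j) ≡ j
  colMap-involutive γ η j = begin
    iterᵖ γ opposite (iterᵖ η halfTurn (iterᵖ γ opposite y))
      ≡⟨ cong (iterᵖ γ opposite)
              (iterᵖ-comm {f = halfTurn} {g = iterᵖ γ opposite} (λ x → sym (iterᵖ-opposite-halfTurn γ x)) η y) ⟩
    iterᵖ γ opposite (iterᵖ γ opposite (iterᵖ η halfTurn y)) ≡⟨ iterᵖ-involutive opposite-involutive γ _ ⟩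
    iterᵖ η halfTurn y                                       ≡⟨ iterᵖ-involutive halfTurn-involutive η j ⟩
    j                                                        ∎
    where
    open ≡-Reasoning
    y : Fin n
    y = iterᵖ η halfTurn j

  side-iterᵖ-opposite : ∀ γ j → side (iterᵖ γ opposite j) ≡ γ ℙ.+ side j
  side-iterᵖ-opposite 0ℙ j = refl
  side-iterᵖ-opposite 1ℙ j = side-opposite j

  -- A moves row i to row i + r (mod m) and, after k passages through the twisted edge,
  -- acts on the columns by colMap (β + parity k) η.
  RowShift : (Vertex m n → Vertex m n) → ℕ → Parity → Parity → Set
  RowShift A r β η = ∀ i j → Σ ℕ λ k →
    (toℕ (proj₁ (A (i , j))) + k * m ≡ toℕ i + r) × (proj₂ (A (i , j)) ≡ colMap (β ℙ.+ parity k) η j)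

  rowShift-id : RowShift id 0 0ℙ 0ℙ
  rowShift-id i j = 0 , refl , refl

  rowShift-H : ∀ {A r β η} → RowShift A r β η → RowShift (Hmap ∘ A) r β (η ⁻¹)
  rowShift-H {A} {r} {β} {η} shift i j with shift i j
  ... | k , row≡ , col≡ = k , row≡ , (begin
    halfTurn (proj₂ (A (i , j)))                         ≡⟨ cong halfTurn col≡ ⟩
    halfTurn (iterᵖ γ opposite (iterᵖ η halfTurn j))     ≡⟨ iterᵖ-opposite-halfTurn γ _ ⟨
    iterᵖ γ opposite (halfTurn (iterᵖ η halfTurn j))
      ≡⟨ cong (iterᵖ γ opposite) (iterᵖ-⁻¹ halfTurn-involutive η j) ⟨
    iterᵖ γ opposite (iterᵖ (η ⁻¹) halfTurn j)           ∎)
    where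
    open ≡-Reasoning
    γ : Parity
    γ = β ℙ.+ parity k

  rowShift-F : ∀ {A r β η} → RowShift A r β η → RowShift (Fmap ∘ A) r (β ⁻¹) η
  rowShift-F {A} {r} {β} {η} shift i j with shift i j
  ... | k , row≡ , col≡ = k , row≡ , (begin
    opposite (proj₂ (A (i , j)))           ≡⟨ cong opposite col≡ ⟩
    opposite (colMap (β ℙ.+ parity k) η j) ≡⟨ iterᵖ-⁻¹ opposite-involutive (β ℙ.+ parity k) _ ⟨
    colMap ((β ℙ.+ parity k) ⁻¹) η j       ≡⟨ cong (λ γ → colMap γ η j) (p⁻¹+q≡[p+q]⁻¹ β (parity k)) ⟨
    colMap (β ⁻¹ ℙ.+ parity k) η j         ∎)
    where open ≡-Reasoning

  rowShift-U : ∀ {A r β η} → RowShift A r β η → RowShift (Umap ∘ A) (suc r) β η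
  rowShift-U {A} {r} {β} {η} shift i j with A (i , j) | shift i j
  ... | (i₀ , j₀) | k , row≡ , col≡ = step (uStep i₀ j₀)
    where
    open ≡-Reasoning
    step : ∀ {w} → UStep i₀ j₀ w → Σ ℕ λ k′ →
           (toℕ (proj₁ w) + k′ * m ≡ toℕ i + suc r) × (proj₂ w ≡ colMap (β ℙ.+ parity k′) η j)
    step (up p) = k , (begin
      toℕ (fromℕ< p) + k * m ≡⟨ cong (_+ k * m) (toℕ-fromℕ< p) ⟩
      suc (toℕ i₀ + k * m)   ≡⟨ cong suc row≡ ⟩
      suc (toℕ i + r)        ≡⟨ +-suc (toℕ i) r ⟨
      toℕ i + suc r          ∎) , col≡
    step (wrap last) = suc k , (begin
      m + k * m              ≡⟨ cong (_+ k * m) last ⟨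
      suc (toℕ i₀ + k * m)   ≡⟨ cong suc row≡ ⟩
      suc (toℕ i + r)        ≡⟨ +-suc (toℕ i) r ⟨
      toℕ i + suc r          ∎) , (begin
      opposite j₀                            ≡⟨ cong opposite col≡ ⟩
      opposite (colMap (β ℙ.+ parity k) η j) ≡⟨ iterᵖ-⁻¹ opposite-involutive (β ℙ.+ parity k) _ ⟨
      colMap ((β ℙ.+ parity k) ⁻¹) η j       ≡⟨ cong (λ γ → colMap γ η j) (p+q⁻¹≡[p+q]⁻¹ β (parity k)) ⟨
      colMap (β ℙ.+ parity k ⁻¹) η j         ≡⟨ cong (λ p → colMap (β ℙ.+ p) η j) (parity-suc k) ⟨
      colMap (β ℙ.+ parity (suc k)) η j      ∎)

  rowShift : ∀ {A} → InKBLS A → Σ ℕ λ r → Σ Parity λ β → Σ Parity λ η → RowShift A r β η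
  rowShift kb-id = 0 , 0ℙ , 0ℙ , rowShift-id
  rowShift (kb-U A) with rowShift A
  ... | r , β , η , shift = suc r , β , η , rowShift-U {β = β} {η} shift
  rowShift (kb-H A) with rowShift A
  ... | r , β , η , shift = r , β , η ⁻¹ , rowShift-H {β = β} {η} shift
  rowShift (kb-F A) with rowShift A
  ... | r , β , η , shift = r , β ⁻¹ , η , rowShift-F {β = β} {η} shift

  rowShift-rowPreserving : ∀ {A r β η} → RowShift A r β η → ∀ i₀ j₀ → proj₁ (A (i₀ , j₀)) ≡ i₀ →
                           Σ Parity λ γ → ∀ i j → A (i , j) ≡ (i , colMap γ η j)
  rowShift-rowPreserving {A} {r} {β} {η} shift i₀ j₀ fixed with shift i₀ j₀
  ... | k₀ , row₀ , _ = β ℙ.+ parity k₀ , sameRow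
    where
    r≡ : r ≡ k₀ * m
    r≡ = sym (+-cancelˡ-≡ (toℕ i₀) _ _ (trans (cong (λ x → toℕ x + k₀ * m) (sym fixed)) row₀))
    sameRow : ∀ i j → A (i , j) ≡ (i , colMap (β ℙ.+ parity k₀) η j)
    sameRow i j with shift i j
    ... | k , row≡ , col≡
      with divMod-unique k k₀ (toℕ<n (proj₁ (A (i , j)))) (toℕ<n i) (trans row≡ (cong (toℕ i +_) r≡))
    ... | row≡i , refl = cong₂ _,_ (toℕ-injective row≡i) col≡

module Construction (m′ h′ : ℕ) where

  open Grid m′ h′

  radix : ∀ {a b c} → a * b * c ≡ m * n → ((Fin a × Fin b) × Fin c) ↔ Fin (m * n)
  radix eq = Perm.cast-id eq ↔-∘ (↔-sym *↔× ↔-∘ (↔-sym *↔× ×-↔ ↔-id _))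

  toℕ-radix : ∀ {a b c} (eq : a * b * c ≡ m * n) x y z →
              toℕ (Inverse.to (radix {a} {b} {c} eq) ((x , y) , z)) ≡ c * (b * toℕ x + toℕ y) + toℕ z
  toℕ-radix {b = b} {c} eq x y z = begin
    toℕ (cast eq (combine (combine x y) z)) ≡⟨ toℕ-cast eq _ ⟩
    toℕ (combine (combine x y) z)           ≡⟨ toℕ-combine (combine x y) z ⟩
    c * toℕ (combine x y) + toℕ z           ≡⟨ cong (λ w → c * w + toℕ z) (toℕ-combine x y) ⟩
    c * (b * toℕ x + toℕ y) + toℕ z         ∎
    where open ≡-Reasoning

  radix-opposite : ∀ {a b c} (eq : a * b * c ≡ m * n) x y z →
                   Inverse.to (radix {a} {b} {c} eq) ((opposite x , opposite y) , opposite z) ≡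
                   opposite (Inverse.to (radix eq) ((x , y) , z))
  radix-opposite eq x y z = begin
    cast eq (combine (combine (opposite x) (opposite y)) (opposite z))
      ≡⟨ cong (λ w → cast eq (combine w (opposite z))) (combine-opposite x y) ⟩
    cast eq (combine (opposite (combine x y)) (opposite z)) ≡⟨ cong (cast eq) (combine-opposite (combine x y) z) ⟩
    cast eq (opposite (combine (combine x y) z))            ≡⟨ cast-opposite eq _ ⟩
    opposite (cast eq (combine (combine x y) z))            ∎
    where open ≡-Reasoning

  rowDigits↔ : (Fin m × Parity) ↔ (Fin 2 × Fin m)
  rowDigits↔ = mk↔ₛ′ to from to-from from-to
    where
    to : Fin m × Parity → Fin 2 × Fin m
    to (k , 0ℙ) = 0F , k
    to (k , 1ℙ) = 1F , opposite k
    from : Fin 2 × Fin m → Fin m × Parity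
    from (0F , k) = k , 0ℙ
    from (1F , k) = opposite k , 1ℙ
    to-from : ∀ x → to (from x) ≡ x
    to-from (0F , k) = refl
    to-from (1F , k) = cong (1F ,_) (opposite-involutive k)
    from-to : ∀ x → from (to x) ≡ x
    from-to (k , 0ℙ) = refl
    from-to (k , 1ℙ) = cong (_, 1ℙ) (opposite-involutive k)

  rowDigits : Fin m × Parity → Fin 2 × Fin m
  rowDigits = Inverse.to rowDigits↔

  complementRow : Fin m × Parity → Fin m × Parity
  complementRow (k , p) = k , p ⁻¹

  rowDigits-complement : ∀ r → rowDigits (complementRow r) ≡ (opposite (proj₁ (rowDigits r)) , opposite (proj₂ (rowDigits r)))
  rowDigits-complement (k , 0ℙ) = refl
  rowDigits-complement (k , 1ℙ) = cong (0F ,_) (sym (opposite-involutive k))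

  2*m*h≡m*n : 2 * m * h ≡ m * n
  2*m*h≡m*n = sizes m h
    where
    sizes : ∀ m h → 2 * m * h ≡ m * (h + h)
    sizes = solve-∀

  h*2*m≡m*n : h * 2 * m ≡ m * n
  h*2*m≡m*n = sizes m h
    where
    sizes : ∀ m h → h * 2 * m ≡ m * (h + h)
    sizes = solve-∀

  m*h*2≡m*n : m * h * 2 ≡ m * n
  m*h*2≡m*n = sizes m h
    where
    sizes : ∀ m h → m * h * 2 ≡ m * (h + h)
    sizes = solve-∀

  2*h*m≡m*n : 2 * h * m ≡ m * n
  2*h*m≡m*n = sizes m h
    where
    sizes : ∀ m h → 2 * h * m ≡ m * (h + h)
    sizes = solve-∀

  arrange : Fin 4 → ((Fin 2 × Fin m) × Fin h) ↔ Fin (m * n)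
  arrange 0F = radix 2*m*h≡m*n
  arrange 1F = radix h*2*m≡m*n ↔-∘
    mk↔ₛ′ (λ { ((b , k) , u) → (u , b) , k }) (λ { ((u , b) , k) → (b , k) , u }) (λ _ → refl) (λ _ → refl)
  arrange 2F = radix m*h*2≡m*n ↔-∘
    mk↔ₛ′ (λ { ((b , k) , u) → (k , u) , b }) (λ { ((k , u) , b) → (b , k) , u }) (λ _ → refl) (λ _ → refl)
  arrange 3F = radix 2*h*m≡m*n ↔-∘
    mk↔ₛ′ (λ { ((b , k) , u) → (b , u) , k }) (λ { ((b , u) , k) → (b , k) , u }) (λ _ → refl) (λ _ → refl)

  arrange-opposite : ∀ ty b k u → Inverse.to (arrange ty) ((opposite b , opposite k) , opposite u) ≡
                                  opposite (Inverse.to (arrange ty) ((b , k) , u))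
  arrange-opposite 0F b k u = radix-opposite 2*m*h≡m*n b k u
  arrange-opposite 1F b k u = radix-opposite h*2*m≡m*n u b k
  arrange-opposite 2F b k u = radix-opposite m*h*2≡m*n k u b
  arrange-opposite 3F b k u = radix-opposite 2*h*m≡m*n b u k

  layout : Fin 4 → ((Fin m × Parity) × Fin h) ↔ Fin (m * n)
  layout ty = arrange ty ↔-∘ (rowDigits↔ ×-↔ ↔-id _)

  scale : Fin 4 → ℕ
  scale 0F = 1
  scale 1F = m * 2
  scale 2F = 2
  scale 3F = m

  offset : Fin 4 → Fin m × Parity → ℕ
  offset ty r = toℕ (Inverse.to (layout ty) (r , 0F))

  offset-origin : ∀ ty → offset ty (0F , 0ℙ) ≡ 0
  offset-origin 0F = refl
  offset-origin 1F = refl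
  offset-origin 2F = refl
  offset-origin 3F = refl

  layout-value : ∀ ty r u → toℕ (Inverse.to (layout ty) (r , u)) ≡ offset ty r + scale ty * toℕ u
  layout-value 0F r u =
    trans (toℕ-radix 2*m*h≡m*n b k u)
          (trans (regroup m h (toℕ b) (toℕ k) (toℕ u)) (cong (_+ 1 * toℕ u) (sym (toℕ-radix 2*m*h≡m*n b k 0F))))
    where
    b : Fin 2
    b = proj₁ (rowDigits r)
    k : Fin m
    k = proj₂ (rowDigits r)
    regroup : ∀ m h b k u → h * (m * b + k) + u ≡ (h * (m * b + k) + 0) + 1 * u
    regroup = solve-∀
  layout-value 1F r u =
    trans (toℕ-radix h*2*m≡m*n u b k)
          (trans (regroup m h (toℕ b) (toℕ k) (toℕ u)) (cong (_+ m * 2 * toℕ u) (sym (toℕ-radix {h} h*2*m≡m*n 0F b k))))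
    where
    b : Fin 2
    b = proj₁ (rowDigits r)
    k : Fin m
    k = proj₂ (rowDigits r)
    regroup : ∀ m h b k u → m * (2 * u + b) + k ≡ (m * (2 * 0 + b) + k) + m * 2 * u
    regroup = solve-∀
  layout-value 2F r u =
    trans (toℕ-radix m*h*2≡m*n k u b)
          (trans (regroup m h (toℕ b) (toℕ k) (toℕ u)) (cong (_+ 2 * toℕ u) (sym (toℕ-radix m*h*2≡m*n k 0F b))))
    where
    b : Fin 2
    b = proj₁ (rowDigits r)
    k : Fin m
    k = proj₂ (rowDigits r)
    regroup : ∀ m h b k u → 2 * (h * k + u) + b ≡ (2 * (h * k + 0) + b) + 2 * u
    regroup = solve-∀
  layout-value 3F r u =
    trans (toℕ-radix 2*h*m≡m*n b u k)
          (trans (regroup m h (toℕ b) (toℕ k) (toℕ u)) (cong (_+ m * toℕ u) (sym (toℕ-radix 2*h*m≡m*n b 0F k))))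
    where
    b : Fin 2
    b = proj₁ (rowDigits r)
    k : Fin m
    k = proj₂ (rowDigits r)
    regroup : ∀ m h b k u → m * (h * b + u) + k ≡ (m * (h * b + 0) + k) + m * u
    regroup = solve-∀

  layout-complement : ∀ ty r u → Inverse.to (layout ty) (complementRow r , opposite u) ≡ opposite (Inverse.to (layout ty) (r , u))
  layout-complement ty r u = trans (cong (λ d → Inverse.to (arrange ty) (d , opposite u)) (rowDigits-complement r))
                                   (arrange-opposite ty (proj₁ (rowDigits r)) (proj₂ (rowDigits r)) u)

  offset-pair : ∀ ty r → offset ty r + offset ty (complementRow r) ≡ m * n ∸ suc (scale ty * h′)
  offset-pair ty r = sym (begin
    m * n ∸ suc s
      ≡⟨ cong (_∸ suc s) (suc-toℕ+toℕ-opposite (L (r , 0F))) ⟨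
    suc (o + toℕ (opposite (L (r , 0F)))) ∸ suc s
      ≡⟨ cong (λ x → suc (o + toℕ x) ∸ suc s) (layout-complement ty r 0F) ⟨
    suc (o + toℕ (L (complementRow r , opposite 0F))) ∸ suc s
      ≡⟨ cong (λ x → suc (o + x) ∸ suc s) (layout-value ty _ (opposite 0F)) ⟩
    suc (o + (o′ + scale ty * toℕ (opposite {h} 0F))) ∸ suc s
      ≡⟨ cong (λ x → suc (o + (o′ + scale ty * x)) ∸ suc s) (toℕ-fromℕ h′) ⟩
    (o + (o′ + s)) ∸ s ≡⟨ cong (_∸ s) (+-assoc o o′ s) ⟨
    (o + o′ + s) ∸ s   ≡⟨ m+n∸n≡m (o + o′) s ⟩
    o + o′             ∎)
    where
    open ≡-Reasoning
    L : (Fin m × Parity) × Fin h → Fin (m * n)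
    L = Inverse.to (layout ty)
    o o′ s : ℕ
    o = offset ty r
    o′ = offset ty (complementRow r)
    s = scale ty * h′

  rowPart : Permutation′ m → (Fin m → Parity) → Vertex m n → Fin m × Parity
  rowPart π σ (i , j) = π ⟨$⟩ʳ i , σ i ℙ.+ side j

  -- Reflecting on one colour class of the checkerboard makes the column digits of vertical
  -- neighbours complementary (colPart-up).
  colPart : Permutation′ h → Vertex m n → Fin h
  colPart e (i , j) = iterᵖ (color (i , j)) opposite (e ⟨$⟩ʳ rank j)

  vertexDigits : Permutation′ h → Permutation′ m → (Fin m → Parity) → Vertex m n ↔ ((Fin m × Parity) × Fin h)
  vertexDigits e π σ = mk↔ₛ′ to from to-from from-to
    where
    to : Vertex m n → (Fin m × Parity) × Fin h
    to v = rowPart π σ v , colPart e v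
    from : (Fin m × Parity) × Fin h → Vertex m n
    from ((k , p) , u) = i , col s (e ⟨$⟩ˡ iterᵖ (parity (toℕ i) ℙ.+ s) opposite u)
      where
      i : Fin m
      i = π ⟨$⟩ˡ k
      s : Parity
      s = σ i ℙ.+ p
    to-from : ∀ x → to (from x) ≡ x
    to-from ((k , p) , u) = cong₂ _,_ (cong₂ _,_ (inverseʳ π) side≡) (begin
      iterᵖ (parity (toℕ i) ℙ.+ side (col s t)) opposite (e ⟨$⟩ʳ rank (col s t))
        ≡⟨ cong₂ (λ q t → iterᵖ (parity (toℕ i) ℙ.+ q) opposite (e ⟨$⟩ʳ t)) (side-col s t) (rank-col s t) ⟩
      iterᵖ c opposite (e ⟨$⟩ʳ (e ⟨$⟩ˡ iterᵖ c opposite u)) ≡⟨ cong (iterᵖ c opposite) (inverseʳ e) ⟩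
      iterᵖ c opposite (iterᵖ c opposite u)                 ≡⟨ iterᵖ-involutive opposite-involutive c u ⟩
      u                                                     ∎)
      where
      open ≡-Reasoning
      i : Fin m
      i = π ⟨$⟩ˡ k
      s c : Parity
      s = σ i ℙ.+ p
      c = parity (toℕ i) ℙ.+ s
      t : Fin h
      t = e ⟨$⟩ˡ iterᵖ c opposite u
      side≡ : σ i ℙ.+ side (col s t) ≡ p
      side≡ = trans (cong (σ i ℙ.+_) (side-col s t)) (p+[p+q]≡q (σ i) p)
    from-to : ∀ v → from (to v) ≡ v
    from-to (i , j) = begin
      from (to (i , j))                          ≡⟨ cong g (inverseˡ π) ⟩
      g i
        ≡⟨ cong (λ q → i , col q (e ⟨$⟩ˡ iterᵖ (parity (toℕ i) ℙ.+ q) opposite u)) (p+[p+q]≡q (σ i) (side j)) ⟩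
      i , col (side j) (e ⟨$⟩ˡ iterᵖ (color (i , j)) opposite u)
        ≡⟨ cong (λ t → i , col (side j) (e ⟨$⟩ˡ t)) (iterᵖ-involutive opposite-involutive (color (i , j)) _) ⟩
      i , col (side j) (e ⟨$⟩ˡ (e ⟨$⟩ʳ rank j)) ≡⟨ cong (λ t → i , col (side j) t) (inverseˡ e) ⟩
      i , col (side j) (rank j)                  ≡⟨ cong (i ,_) (col-side-rank j) ⟩
      i , j                                      ∎
      where
      open ≡-Reasoning
      u : Fin h
      u = colPart e (i , j)
      p : Parity
      p = σ i ℙ.+ side j
      g : Fin m → Vertex m n
      g i′ = i′ , col (σ i′ ℙ.+ p) (e ⟨$⟩ˡ iterᵖ (parity (toℕ i′) ℙ.+ (σ i′ ℙ.+ p)) opposite u)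

  labeling : Fin 4 → Permutation′ h → Permutation′ m → (Fin m → Parity) → Labeling m n
  labeling ty e π σ = ↔⇒⤖ (layout ty ↔-∘ vertexDigits e π σ)

  toℕ-labeling : ∀ ty e π σ v →
                 toℕ (Bijection.to (labeling ty e π σ) v) ≡ offset ty (rowPart π σ v) + scale ty * toℕ (colPart e v)
  toℕ-labeling ty e π σ v = layout-value ty (rowPart π σ v) (colPart e v)

  rowPart-flip : ∀ π σ i j j′ → side j′ ≡ side j ⁻¹ → rowPart π σ (i , j′) ≡ complementRow (rowPart π σ (i , j))
  rowPart-flip π σ i j j′ flip = cong (π ⟨$⟩ʳ i ,_) (trans (cong (σ i ℙ.+_) flip) (p+q⁻¹≡[p+q]⁻¹ (σ i) (side j)))

  colPart-up : parity m′ ≡ 0ℙ → ∀ e v → colPart e (Umap v) ≡ opposite (colPart e v)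
  colPart-up m′-even e v = trans (cong₂ (λ c t → iterᵖ c opposite (e ⟨$⟩ʳ t)) (up-color m′-even v) (up-rank v))
                                 (iterᵖ-⁻¹ opposite-involutive (color v) _)

  labeling-magic : parity m′ ≡ 0ℙ → ∀ ty e π σ → FaceMagic (labeling ty e π σ)
  labeling-magic m′-even ty e π σ =
    faceMagic-split (labeling ty e π σ) (offset ty ∘ rowPart π σ) (toℕ ∘ colPart e) (scale ty) A h′
      (cong suc ∘ toℕ-labeling ty e π σ) horizontal horizontalUp vertical
    where
    A : ℕ
    A = m * n ∸ suc (scale ty * h′)
    pair : ∀ {r r′} → r′ ≡ complementRow r → offset ty r + offset ty r′ ≡ A
    pair {r} refl = offset-pair ty r
    horizontal : ∀ v → offset ty (rowPart π σ v) + offset ty (rowPart π σ (Rmap v)) ≡ A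
    horizontal (i , j) = pair (rowPart-flip π σ i j (addMod 1 j) (side-right j))
    horizontalUp : ∀ v → offset ty (rowPart π σ (Umap v)) + offset ty (rowPart π σ (Umap (Rmap v))) ≡ A
    horizontalUp v with Umap v | Umap (Rmap v) | up-right v
    ... | (i , j) | (i′ , j′) | refl , flip = pair (rowPart-flip π σ i j j′ flip)
    vertical : ∀ v → toℕ (colPart e v) + toℕ (colPart e (Umap v)) ≡ h′
    vertical v = suc-injective (trans (cong (λ x → suc (toℕ (colPart e v) + toℕ x)) (colPart-up m′-even e v))
                                      (suc-toℕ+toℕ-opposite (colPart e v)))

module Distinctness (m′ h′ : ℕ) (m′≥2 : 2 ≤ m′) (h′≥2 : 2 ≤ h′) where

  open Grid m′ h′
  open Construction m′ h′

  top : Fin h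
  top = fromℕ h′

  mid-bounds : 0 < toℕ mid × toℕ mid < h′
  mid-bounds with ⌊n/2⌋-bounds h (s≤s h′≥2)
  ... | 0<q , q<h′ = subst (0 <_) (sym toℕ-mid) 0<q , subst (_< h′) (sym toℕ-mid) (s≤s⁻¹ q<h′)

  0≢mid : 0F ≢ mid
  0≢mid eq = <-irrefl (cong toℕ eq) (proj₁ mid-bounds)

  mid≢top : mid ≢ top
  mid≢top eq = <-irrefl (trans (cong toℕ eq) (toℕ-fromℕ h′)) (proj₂ mid-bounds)

  0≢top : 0F ≢ top
  0≢top eq = <-irrefl (trans (cong toℕ eq) (toℕ-fromℕ h′)) (<-trans (proj₁ mid-bounds) (proj₂ mid-bounds))

  column : Fin 3 → Permutation′ h
  column 0F = Perm.id
  column 1F = transpose mid top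
  column 2F = transpose 0F mid ∘ₚ transpose 0F top

  anchors : Fin 3 → Fin h × Fin h
  anchors 0F = 0F , mid
  anchors 1F = 0F , top
  anchors 2F = mid , top

  column-anchors : ∀ c → (column c ⟨$⟩ʳ 0F , column c ⟨$⟩ʳ mid) ≡ anchors c
  column-anchors 0F = refl
  column-anchors 1F = cong₂ _,_ (transpose-other 0≢mid 0≢top) (transpose-matchˡ mid top)
  column-anchors 2F = cong₂ _,_
    (trans (cong (transpose 0F top ⟨$⟩ʳ_) (transpose-matchˡ 0F mid)) (transpose-other (0≢mid ∘ sym) mid≢top))
    (trans (cong (transpose 0F top ⟨$⟩ʳ_) (transpose-matchʳ 0F mid)) (transpose-matchˡ 0F top))

  anchors-increasing : ∀ c → toℕ (proj₁ (anchors c)) < toℕ (proj₂ (anchors c))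
  anchors-increasing 0F = proj₁ mid-bounds
  anchors-increasing 1F = subst (0 <_) (sym (toℕ-fromℕ h′)) (<-trans (proj₁ mid-bounds) (proj₂ mid-bounds))
  anchors-increasing 2F = subst (toℕ mid <_) (sym (toℕ-fromℕ h′)) (proj₂ mid-bounds)

  anchors-injective : ∀ c c′ → anchors c ≡ anchors c′ → c ≡ c′
  anchors-injective 0F 0F _  = refl
  anchors-injective 0F 1F eq = ⊥-elim (mid≢top (cong proj₂ eq))
  anchors-injective 0F 2F eq = ⊥-elim (0≢mid (cong proj₁ eq))
  anchors-injective 1F 0F eq = ⊥-elim (mid≢top (sym (cong proj₂ eq)))
  anchors-injective 1F 1F _  = refl
  anchors-injective 1F 2F eq = ⊥-elim (0≢mid (cong proj₁ eq))
  anchors-injective 2F 0F eq = ⊥-elim (0≢mid (sym (cong proj₁ eq)))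
  anchors-injective 2F 1F eq = ⊥-elim (0≢mid (sym (cong proj₁ eq)))
  anchors-injective 2F 2F _  = refl

  column-increasing : ∀ c → toℕ (column c ⟨$⟩ʳ 0F) < toℕ (column c ⟨$⟩ʳ mid)
  column-increasing c = subst (λ p → toℕ (proj₁ p) < toℕ (proj₂ p)) (sym (column-anchors c)) (anchors-increasing c)

  m≢1 : m ≢ 1
  m≢1 eq with subst (2 ≤_) (suc-injective eq) m′≥2
  ... | ()

  m≢2 : m ≢ 2
  m≢2 eq with subst (2 ≤_) (suc-injective eq) m′≥2
  ... | s≤s ()

  2≢1 : 2 ≢ 1
  2≢1 ()

  scale-injective : ∀ ty ty′ → scale ty ≡ scale ty′ → ty ≡ ty′
  scale-injective 0F 0F _  = refl
  scale-injective 0F 1F ()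
  scale-injective 0F 2F ()
  scale-injective 0F 3F eq = ⊥-elim (m≢1 (sym eq))
  scale-injective 1F 0F ()
  scale-injective 1F 1F _  = refl
  scale-injective 1F 2F eq = ⊥-elim (m≢1 (*-cancelʳ-≡ m 1 2 eq))
  scale-injective 1F 3F eq = ⊥-elim (2≢1 (*-cancelˡ-≡ 2 1 m (trans eq (sym (*-identityʳ m)))))
  scale-injective 2F 0F ()
  scale-injective 2F 1F eq = ⊥-elim (m≢1 (*-cancelʳ-≡ m 1 2 (sym eq)))
  scale-injective 2F 2F _  = refl
  scale-injective 2F 3F eq = ⊥-elim (m≢2 (sym eq))
  scale-injective 3F 0F eq = ⊥-elim (m≢1 eq)
  scale-injective 3F 1F eq = ⊥-elim (2≢1 (*-cancelˡ-≡ 2 1 m (trans (sym eq) (sym (*-identityʳ m)))))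
  scale-injective 3F 2F eq = ⊥-elim (m≢2 eq)
  scale-injective 3F 3F _  = refl

  scale-nonZero : ∀ ty → NonZero (scale ty)
  scale-nonZero 0F = _
  scale-nonZero 1F = _
  scale-nonZero 2F = _
  scale-nonZero 3F = _

  Normalised : Permutation′ m → (Fin m → Parity) → Set
  Normalised π σ = π ⟨$⟩ʳ 0F ≡ 0F × σ 0F ≡ 0ℙ

  row0-value : ∀ ty e π σ → Normalised π σ → ∀ t →
               toℕ (Bijection.to (labeling ty e π σ) (0F , col 0ℙ t)) ≡ scale ty * toℕ (e ⟨$⟩ʳ t)
  row0-value ty e π σ (π0 , σ0) t = begin
    toℕ (Bijection.to (labeling ty e π σ) (0F , col 0ℙ t))
      ≡⟨ toℕ-labeling ty e π σ (0F , col 0ℙ t) ⟩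
    offset ty (π ⟨$⟩ʳ 0F , σ 0F ℙ.+ side (col 0ℙ t))
      + scale ty * toℕ (iterᵖ (side (col 0ℙ t)) opposite (e ⟨$⟩ʳ rank (col 0ℙ t)))
      ≡⟨ cong₂ (λ r u → offset ty r + scale ty * toℕ u)
               (cong₂ _,_ π0 (cong₂ ℙ._+_ σ0 (side-col 0ℙ t)))
               (cong₂ (λ p x → iterᵖ p opposite (e ⟨$⟩ʳ x)) (side-col 0ℙ t) (rank-col 0ℙ t)) ⟩
    offset ty (0F , 0ℙ) + scale ty * toℕ (e ⟨$⟩ʳ t)
      ≡⟨ cong (_+ scale ty * toℕ (e ⟨$⟩ʳ t)) (offset-origin ty) ⟩
    scale ty * toℕ (e ⟨$⟩ʳ t) ∎
    where open ≡-Reasoning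

  rows-determined : ∀ ty e {π σ π′ σ′} →
                    (∀ v → Bijection.to (labeling ty e π′ σ′) v ≡ Bijection.to (labeling ty e π σ) v) →
                    (∀ i → π ⟨$⟩ʳ i ≡ π′ ⟨$⟩ʳ i) × (∀ i → σ i ≡ σ′ i)
  rows-determined ty e {π} {σ} {π′} {σ′} same =
    (λ i → sym (cong proj₁ (rows i))) , (λ i → sym (ℙₚ.+-cancelʳ-≡ (side 0F) _ _ (cong proj₂ (rows i))))
    where
    rows : ∀ i → rowPart π′ σ′ (i , 0F) ≡ rowPart π σ (i , 0F)
    rows i = cong proj₁ (Injection.injective (↔⇒↣ (layout ty)) (same (i , 0F)))

  parameters-determined : ∀ {ty ty′ c c′ π π′ σ σ′} → Normalised π σ → Normalised π′ σ′ →
    (∀ v → Bijection.to (labeling ty′ (column c′) π′ σ′) v ≡ Bijection.to (labeling ty (column c) π σ) v) →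
    ty ≡ ty′ × c ≡ c′ × (∀ i → π ⟨$⟩ʳ i ≡ π′ ⟨$⟩ʳ i) × (∀ i → σ i ≡ σ′ i)
  parameters-determined {ty} {ty′} {c} {c′} {π} {π′} {σ} {σ′} norm norm′ same =
    ty≡ , c≡ , rows {π = π} {π′} {σ} {σ′} ty≡ c≡ same
    where
    e e′ : Permutation′ h
    e = column c
    e′ = column c′
    row0 : ∀ t → scale ty′ * toℕ (e′ ⟨$⟩ʳ t) ≡ scale ty * toℕ (e ⟨$⟩ʳ t)
    row0 t = trans (sym (row0-value ty′ e′ π′ σ′ norm′ t))
                   (trans (cong toℕ (same (0F , col 0ℙ t))) (row0-value ty e π σ norm t))
    1<h : 1 < h
    1<h = s≤s (≤-trans (s≤s z≤n) h′≥2)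
    -- The label scale * 1 occurs in row 0 of each labeling, so each scale divides the other.
    divides : ∀ {s s′} (e e′ : Permutation′ h) →
              (∀ t → s′ * toℕ (e′ ⟨$⟩ʳ t) ≡ s * toℕ (e ⟨$⟩ʳ t)) → s′ ∣ s
    divides {s} {s′} e e′ row = subst (s′ ∣_) (begin
      s′ * toℕ (e′ ⟨$⟩ʳ (e ⟨$⟩ˡ fromℕ< 1<h)) ≡⟨ row (e ⟨$⟩ˡ fromℕ< 1<h) ⟩
      s * toℕ (e ⟨$⟩ʳ (e ⟨$⟩ˡ fromℕ< 1<h))   ≡⟨ cong (λ x → s * toℕ x) (inverseʳ e) ⟩
      s * toℕ (fromℕ< 1<h)                   ≡⟨ cong (s *_) (toℕ-fromℕ< 1<h) ⟩
      s * 1                                  ≡⟨ *-identityʳ s ⟩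
      s                                      ∎) (m∣m*n (toℕ (e′ ⟨$⟩ʳ (e ⟨$⟩ˡ fromℕ< 1<h))))
      where open ≡-Reasoning
    scales : scale ty ≡ scale ty′
    scales = ∣-antisym (divides e′ e (sym ∘ row0)) (divides e e′ row0)
    ty≡ : ty ≡ ty′
    ty≡ = scale-injective ty ty′ scales
    values : ∀ t → e ⟨$⟩ʳ t ≡ e′ ⟨$⟩ʳ t
    values t = toℕ-injective (*-cancelˡ-≡ _ _ (scale ty) ⦃ scale-nonZero ty ⦄
                 (trans (sym (row0 t)) (cong (_* toℕ (e′ ⟨$⟩ʳ t)) (sym scales))))
    c≡ : c ≡ c′
    c≡ = anchors-injective c c′ (trans (sym (column-anchors c)) (trans (cong₂ _,_ (values 0F) (values mid)) (column-anchors c′)))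
    rows : ∀ {ty ty′ c c′ π π′ σ σ′} → ty ≡ ty′ → c ≡ c′ →
           (∀ v → Bijection.to (labeling ty′ (column c′) π′ σ′) v ≡ Bijection.to (labeling ty (column c) π σ) v) →
           (∀ i → π ⟨$⟩ʳ i ≡ π′ ⟨$⟩ʳ i) × (∀ i → σ i ≡ σ′ i)
    rows {ty} {c = c} {π = π} {π′} {σ} {σ′} refl refl = rows-determined ty (column c) {π} {σ} {π′} {σ′}

  no-swap : ∀ {ty ty′ c c′ π π′ σ σ′} → Normalised π σ → Normalised π′ σ′ → (A : Vertex m n → Vertex m n) →
    (∀ v → Bijection.to (labeling ty′ (column c′) π′ σ′) v ≡ Bijection.to (labeling ty (column c) π σ) (A v)) →
    A (0F , col 0ℙ 0F) ≡ (0F , col 0ℙ mid) → A (0F , col 0ℙ mid) ≡ (0F , col 0ℙ 0F) → ⊥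
  no-swap {ty} {ty′} {c} {c′} {π} {π′} {σ} {σ′} norm norm′ A same A₀ A₁ = <-irrefl refl (begin-strict
    s * toℕ (e ⟨$⟩ʳ 0F)    <⟨ *-monoʳ-< s ⦃ scale-nonZero ty ⦄ (column-increasing c) ⟩
    s * toℕ (e ⟨$⟩ʳ mid)   ≡⟨ relate 0F mid A₀ ⟨
    s′ * toℕ (e′ ⟨$⟩ʳ 0F)  <⟨ *-monoʳ-< s′ ⦃ scale-nonZero ty′ ⦄ (column-increasing c′) ⟩
    s′ * toℕ (e′ ⟨$⟩ʳ mid) ≡⟨ relate mid 0F A₁ ⟩
    s * toℕ (e ⟨$⟩ʳ 0F)    ∎)
    where
    open ≤-Reasoning
    e e′ : Permutation′ h
    e = column c
    e′ = column c′
    s s′ : ℕ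
    s = scale ty
    s′ = scale ty′
    relate : ∀ t t′ → A (0F , col 0ℙ t) ≡ (0F , col 0ℙ t′) →
             s′ * toℕ (e′ ⟨$⟩ʳ t) ≡ s * toℕ (e ⟨$⟩ʳ t′)
    relate t t′ At = trans (sym (row0-value ty′ e′ π′ σ′ norm′ t))
                           (trans (cong toℕ (trans (same _) (cong (Bijection.to (labeling ty e π σ)) At)))
                                  (row0-value ty e π σ norm t′))

  labelings-distinct : ∀ {ty ty′ c c′ π π′ σ σ′} → Normalised π σ → Normalised π′ σ′ →
    KBEquivalent (labeling ty (column c) π σ) (labeling ty′ (column c′) π′ σ′) →
    ty ≡ ty′ × c ≡ c′ × (∀ i → π ⟨$⟩ʳ i ≡ π′ ⟨$⟩ʳ i) × (∀ i → σ i ≡ σ′ i)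
  labelings-distinct {ty} {ty′} {c} {c′} {π} {π′} {σ} {σ′} norm norm′ (A , A∈ , relabel) =
    byColumnMap η (rowShift-rowPreserving {β = β} {η} shift 0F (col 0ℙ t′) (cong proj₁ A-one))
    where
    L L′ : Labeling m n
    L = labeling ty (column c) π σ
    L′ = labeling ty′ (column c′) π′ σ′
    same : ∀ v → Bijection.to L′ v ≡ Bijection.to L (A v)
    same v = toℕ-injective (suc-injective (relabel v))
    t t′ : Fin h
    t = column c ⟨$⟩ˡ 0F
    t′ = column c′ ⟨$⟩ˡ 0F
    labelled-one : ∀ ty e π σ → Normalised π σ →
                   toℕ (Bijection.to (labeling ty e π σ) (0F , col 0ℙ (e ⟨$⟩ˡ 0F))) ≡ 0
    labelled-one ty e π σ norm =
      trans (row0-value ty e π σ norm _) (trans (cong (λ x → scale ty * toℕ x) (inverseʳ e)) (*-zeroʳ (scale ty)))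
    A-one : A (0F , col 0ℙ t′) ≡ (0F , col 0ℙ t)
    A-one = Bijection.injective L (toℕ-injective (trans (cong toℕ (sym (same _)))
              (trans (labelled-one ty′ (column c′) π′ σ′ norm′) (sym (labelled-one ty (column c) π σ norm)))))
    β η : Parity
    β = proj₁ (proj₂ (rowShift A∈))
    η = proj₁ (proj₂ (proj₂ (rowShift A∈)))
    shift : RowShift A (proj₁ (rowShift A∈)) β η
    shift = proj₂ (proj₂ (proj₂ (rowShift A∈)))
    side-t′ : ∀ γ η → side (colMap γ η (col 0ℙ t′)) ≡ γ ℙ.+ (η ℙ.* parity h)
    side-t′ γ 0ℙ = trans (side-iterᵖ-opposite γ (col 0ℙ t′)) (cong (γ ℙ.+_) (side-col 0ℙ t′))
    side-t′ γ 1ℙ = trans (side-iterᵖ-opposite γ (halfTurn (col 0ℙ t′)))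
                         (cong (γ ℙ.+_) (trans (side-halfTurn (col 0ℙ t′)) (cong (ℙ._+ parity h) (side-col 0ℙ t′))))
    side-zero : ∀ η γ → (∀ i j → A (i , j) ≡ (i , colMap γ η j)) → side (colMap γ η (col 0ℙ t′)) ≡ 0ℙ
    side-zero η γ rowwise = trans (cong (side ∘ proj₂) (trans (sym (rowwise 0F (col 0ℙ t′))) A-one)) (side-col 0ℙ t)
    classify : ∀ η γ → (∀ i j → A (i , j) ≡ (i , colMap γ η j)) → η ℙ.* parity h ≡ γ →
               ty ≡ ty′ × c ≡ c′ × (∀ i → π ⟨$⟩ʳ i ≡ π′ ⟨$⟩ʳ i) × (∀ i → σ i ≡ σ′ i)
    classify 0ℙ 0ℙ rowwise _ =
      parameters-determined {ty} {ty′} {c} {c′} {π} {π′} {σ} {σ′} norm norm′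
        (λ v → trans (same v) (cong (Bijection.to L) (A-id v)))
      where
      A-id : ∀ v → A v ≡ v
      A-id (i , j) = rowwise i j
    classify 0ℙ 1ℙ rowwise ()
    classify 1ℙ γ rowwise γ≡ = ⊥-elim (no-swap {ty} {ty′} {c} {c′} {π} {π′} {σ} {σ′} norm norm′ A same A₀ A₁)
      where
      rowwise′ : ∀ i j → A (i , j) ≡ (i , colMap (parity h) 1ℙ j)
      rowwise′ i j = trans (rowwise i j) (cong (λ γ → i , colMap γ 1ℙ j) (sym γ≡))
      A₀ : A (0F , col 0ℙ 0F) ≡ (0F , col 0ℙ mid)
      A₀ = trans (rowwise′ 0F (col 0ℙ 0F)) (cong (0F ,_) halfTurn-col0)
      A₁ : A (0F , col 0ℙ mid) ≡ (0F , col 0ℙ 0F)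
      A₁ = trans (rowwise′ 0F (col 0ℙ mid))
             (cong (0F ,_) (trans (cong (colMap (parity h) 1ℙ) (sym halfTurn-col0)) (colMap-involutive (parity h) 1ℙ (col 0ℙ 0F))))
    byColumnMap : ∀ η → (Σ Parity λ γ → ∀ i j → A (i , j) ≡ (i , colMap γ η j)) →
                  ty ≡ ty′ × c ≡ c′ × (∀ i → π ⟨$⟩ʳ i ≡ π′ ⟨$⟩ʳ i) × (∀ i → σ i ≡ σ′ i)
    byColumnMap η (γ , rowwise) =
      classify η γ rowwise (p+q≡0ℙ⇒q≡p γ (η ℙ.* parity h) (trans (sym (side-t′ γ η)) (side-zero η γ rowwise)))

module Family (m′ h′ : ℕ) (m′-even : parity m′ ≡ 0ℙ) (m′≥2 : 2 ≤ m′) (h′≥2 : 2 ≤ h′) where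

  open Grid m′ h′
  open Construction m′ h′
  open Distinctness m′ h′ m′≥2 h′≥2

  Code : Set
  Code = ((Fin 4 × Fin 3) × Fin (2 ^ m′)) × Fin (m′ !)

  labelingOf : Code → Labeling m n
  labelingOf (((ty , c) , s) , p) = labeling ty (column c) (lift₀ (lehmer m′ p)) (0ℙ ∷ signs m′ s)

  labelingOf-distinct : ∀ x y → KBEquivalent (labelingOf x) (labelingOf y) → x ≡ y
  labelingOf-distinct (((ty , c) , s) , p) (((ty′ , c′) , s′) , p′) equivalent =
    cong₂ _,_ (cong₂ _,_ (cong₂ _,_ ty≡ c≡) (signs-injective m′ (σ≡ ∘ Fin.suc)))
              (lehmer-injective m′ (Finₚ.suc-injective ∘ π≡ ∘ Fin.suc))
    where
    π π′ : Permutation′ m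
    π = lift₀ (lehmer m′ p)
    π′ = lift₀ (lehmer m′ p′)
    σ σ′ : Fin m → Parity
    σ = 0ℙ ∷ signs m′ s
    σ′ = 0ℙ ∷ signs m′ s′
    parameters : ty ≡ ty′ × c ≡ c′ × (∀ i → π ⟨$⟩ʳ i ≡ π′ ⟨$⟩ʳ i) × (∀ i → σ i ≡ σ′ i)
    parameters = labelings-distinct {ty} {ty′} {c} {c′} {π} {π′} {σ} {σ′} (refl , refl) (refl , refl) equivalent
    ty≡ : ty ≡ ty′
    ty≡ = proj₁ parameters
    c≡ : c ≡ c′
    c≡ = proj₁ (proj₂ parameters)
    π≡ : ∀ i → π ⟨$⟩ʳ i ≡ π′ ⟨$⟩ʳ i
    π≡ = proj₁ (proj₂ (proj₂ parameters))
    σ≡ : ∀ i → σ i ≡ σ′ i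
    σ≡ = proj₂ (proj₂ (proj₂ parameters))

  family-size : 6 * 2 ^ m * m′ ! ≡ 4 * 3 * 2 ^ m′ * m′ !
  family-size = regroup (2 ^ m′) (m′ !)
    where
    regroup : ∀ x y → 6 * (2 * x) * y ≡ 4 * 3 * x * y
    regroup = solve-∀

  nonequivalentMagicLabelings : AtLeastNonequivMagic m n (6 * 2 ^ m * m′ !)
  nonequivalentMagicLabelings =
    AtLeastNonequivMagic-↣ (↔⇒↣ (*↔×₄ ↔-∘ Perm.cast-id family-size)) labelingOf
      (λ { (((ty , c) , s) , p) → labeling-magic m′-even ty (column c) (lift₀ (lehmer m′ p)) (0ℙ ∷ signs m′ s) })
      labelingOf-distinct

theorem7p5 : (m n : ℕ) → 3 ≤ m → m % 2 ≡ 1 → 6 ≤ n → n % 2 ≡ 0 →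
    ((n % 4 ≡ 2 → AtLeastNonequivMagic m n ((6 * 2 ^ m) * ((m ∸ 1) !)))
    × (n % 4 ≡ 0 → AtLeastNonequivMagic m n ((5 * 2 ^ m) * ((m ∸ 1) !))))
theorem7p5 (suc m′) n (s≤s m′≥2) m-odd 6≤n n-even with even-split n n-even 6≤n
... | h′ , h′≥2 , refl = (λ _ → labelings) , (λ _ → AtLeastNonequivMagic-≤ 5·≤6· labelings)
  where
  m′-even : parity m′ ≡ 0ℙ
  m′-even = ℙₚ.⁻¹-injective (trans (sym (parity-suc m′)) (parity-odd (suc m′) m-odd))
  labelings : AtLeastNonequivMagic (suc m′) (suc h′ + suc h′) (6 * 2 ^ suc m′ * m′ !)
  labelings = Family.nonequivalentMagicLabelings m′ h′ m′-even m′≥2 h′≥2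
  5·≤6· : 5 * 2 ^ suc m′ * m′ ! ≤ 6 * 2 ^ suc m′ * m′ !
  5·≤6· = *-monoˡ-≤ (m′ !) (*-monoˡ-≤ (2 ^ suc m′) (n≤1+n 5))
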